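{- For every $k\in\mathbb{N}_0$ and every $s\in\{0,\dots,2^k\}$: (i) $\hat r_k(s)+\hat r_k(2^k-s)=\hat h_k(s)$; (ii) $\hat h_k(2^k-s)=\hat h_k(s)$.
   Context: Define $\hat h_k,\hat r_k:\{0,\dots,2^k\}\to\mathbb{N}_0$ recursively by $\hat h_0(0)=\hat h_0(1)=1$, $\hat r_0(0)=0$, $\hat r_0(1)=1$, and for $s\in\{0,\dots,2^k\}$: $\hat h_{k+1}(2s)=\hat h_k(s)$, $\hat r_{k+1}(2s)=\hat r_k(s)$; for $s\in\{0,\dots,2^k-1\}$: $\hat h_{k+1}(2s+1)=\hat h_k(s)+\hat h_k(s+1)$, $\hat r_{k+1}(2s+1)=\hat r_k(s)+\hat r_k(s+1)$. -}

module Defs where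

open import Data.Nat using (ℕ; zero; suc; _+_)
open import Data.Nat.Base using (_/_; _%_)

-- Hat h_k and hat r_k, defined on all of ℕ as total functions;
-- only the values at s ∈ {0,…,2^k} are meaningful (and they agree
-- with the paper's recursion there).

hh : ℕ → ℕ → ℕ
hh zero s = 1
hh (suc k) s with s % 2
... | zero = hh k (s / 2)
... | suc _ = hh k (s / 2) + hh k (suc (s / 2))

rr : ℕ → ℕ → ℕ
rr zero zero = 0
rr zero (suc _) = 1
rr (suc k) s with s % 2
... | zero = rr k (s / 2)
... | suc _ = rr k (s / 2) + rr k (suc (s / 2))

{-# OPTIONS --safe #-}
module Submission where

-- If s + d = 2^(k+1), then either s = 2t, d = 2e with t + e = 2^k, or
-- s = 2t+1, d = 2u+1, where both (t, u+1) and (t+1, u) sum to 2^k.  In the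
-- odd case these two pairs supply, by induction on k, exactly the two summands
-- hh_k(t) and hh_k(t+1) of hh_(k+1)(2t+1); the even case is immediate.

open import Defs
open import Data.Nat using (ℕ; zero; suc; _+_; _*_; _∸_; _^_; _≤_; _/_; _%_)
open import Data.Nat.Properties
  using (+-suc; +-comm; *-comm; *-distribʳ-+; *-cancelʳ-≡; suc-injective; m+[n∸m]≡n;
         +-commutativeSemigroup)
open import Data.Nat.DivMod using (m*n%n≡0; m*n/n≡m; [m+kn]%n≡m%n; +-distrib-/-∣ʳ)
open import Data.Nat.Divisibility using (divides-refl)
open import Algebra.Properties.CommutativeSemigroup +-commutativeSemigroup using (interchange)
open import Data.Product using (_×_; _,_)
open import Relation.Binary.PropositionalEquality
open import Relation.Nullary using (contradiction)
open ≡-Reasoning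

[t*2]%2≡0 : ∀ t → t * 2 % 2 ≡ 0
[t*2]%2≡0 t = m*n%n≡0 t 2

[t*2]/2≡t : ∀ t → t * 2 / 2 ≡ t
[t*2]/2≡t t = m*n/n≡m t 2

[1+t*2]%2≡1 : ∀ t → suc (t * 2) % 2 ≡ 1
[1+t*2]%2≡1 t = [m+kn]%n≡m%n 1 t 2

[1+t*2]/2≡t : ∀ t → suc (t * 2) / 2 ≡ t
[1+t*2]/2≡t t = trans (+-distrib-/-∣ʳ 1 {d = 2} (divides-refl t)) (m*n/n≡m t 2)

hh-even : ∀ k t → hh (suc k) (t * 2) ≡ hh k t
hh-even k t rewrite [t*2]%2≡0 t | [t*2]/2≡t t = refl

hh-odd : ∀ k t → hh (suc k) (suc (t * 2)) ≡ hh k t + hh k (suc t)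
hh-odd k t rewrite [1+t*2]%2≡1 t | [1+t*2]/2≡t t = refl

rr-even : ∀ k t → rr (suc k) (t * 2) ≡ rr k t
rr-even k t rewrite [t*2]%2≡0 t | [t*2]/2≡t t = refl

rr-odd : ∀ k t → rr (suc k) (suc (t * 2)) ≡ rr k t + rr k (suc t)
rr-odd k t rewrite [1+t*2]%2≡1 t | [1+t*2]/2≡t t = refl

odd≢even : ∀ m n → suc (m * 2) ≢ n * 2
odd≢even zero (suc n) ()
odd≢even (suc m) (suc n) eq = odd≢even m n (suc-injective (suc-injective eq))

even+odd≢even : ∀ a b n → a * 2 + suc (b * 2) ≢ n * 2
even+odd≢even a b n eq = odd≢even (a + b) n (begin
  suc ((a + b) * 2)       ≡⟨ cong suc (*-distribʳ-+ 2 a b) ⟩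
  suc (a * 2 + b * 2)     ≡⟨ +-suc (a * 2) (b * 2) ⟨
  a * 2 + suc (b * 2)     ≡⟨ eq ⟩
  n * 2                   ∎)

halve-sum : ∀ a b n → a * 2 + b * 2 ≡ n * 2 → a + b ≡ n
halve-sum a b n eq = *-cancelʳ-≡ (a + b) n 2 (trans (*-distribʳ-+ 2 a b) eq)

data Parity : ℕ → Set where
  even : ∀ t → Parity (t * 2)
  odd  : ∀ t → Parity (suc (t * 2))

parity : ∀ n → Parity n
parity zero = even zero
parity (suc zero) = odd zero
parity (suc (suc n)) with parity n
... | even t = even (suc t)
... | odd t  = odd (suc t)

data Halves (n : ℕ) : ℕ → ℕ → Set where
  evens : ∀ t e → t + e ≡ n → Halves n (t * 2) (e * 2)
  odds  : ∀ t u → suc t + u ≡ n → Halves n (suc (t * 2)) (suc (u * 2))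

halves : ∀ n s d → s + d ≡ 2 * n → Halves n s d
halves n s d eq with parity s | parity d | trans eq (*-comm 2 n)
... | even t | even e | eq′ = evens t e (halve-sum t e n eq′)
... | even t | odd u  | eq′ = contradiction eq′ (even+odd≢even t u n)
... | odd u  | even t | eq′ = contradiction (trans (+-comm (t * 2) _) eq′) (even+odd≢even t u n)
... | odd t  | odd u  | eq′ =
  odds t u (halve-sum (suc t) u n (trans (cong suc (sym (+-suc (t * 2) (u * 2)))) eq′))

hh-symmetric : ∀ k s d → s + d ≡ 2 ^ k → hh k d ≡ hh k s
hh-symmetric zero s d _ = refl
hh-symmetric (suc k) s d eq with halves (2 ^ k) s d eq
... | evens t e t+e≡ = begin
  hh (suc k) (e * 2)  ≡⟨ hh-even k e ⟩
  hh k e              ≡⟨ hh-symmetric k t e t+e≡ ⟩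
  hh k t              ≡⟨ hh-even k t ⟨
  hh (suc k) (t * 2)  ∎
... | odds t u 1+t+u≡ = begin
  hh (suc k) (suc (u * 2))  ≡⟨ hh-odd k u ⟩
  hh k u + hh k (suc u)     ≡⟨ cong₂ _+_ (hh-symmetric k (suc t) u 1+t+u≡)
                                          (hh-symmetric k t (suc u) (trans (+-suc t u) 1+t+u≡)) ⟩
  hh k (suc t) + hh k t     ≡⟨ +-comm (hh k (suc t)) (hh k t) ⟩
  hh k t + hh k (suc t)     ≡⟨ hh-odd k t ⟨
  hh (suc k) (suc (t * 2))  ∎

rr-complement : ∀ k s d → s + d ≡ 2 ^ k → rr k s + rr k d ≡ hh k s
rr-complement zero zero .1 refl = refl
rr-complement zero (suc zero) zero refl = refl
rr-complement (suc k) s d eq with halves (2 ^ k) s d eq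
... | evens t e t+e≡ = begin
  rr (suc k) (t * 2) + rr (suc k) (e * 2)  ≡⟨ cong₂ _+_ (rr-even k t) (rr-even k e) ⟩
  rr k t + rr k e                          ≡⟨ rr-complement k t e t+e≡ ⟩
  hh k t                                   ≡⟨ hh-even k t ⟨
  hh (suc k) (t * 2)                       ∎
... | odds t u 1+t+u≡ = begin
  rr (suc k) (suc (t * 2)) + rr (suc k) (suc (u * 2))
    ≡⟨ cong₂ _+_ (rr-odd k t) (rr-odd k u) ⟩
  (rr k t + rr k (suc t)) + (rr k u + rr k (suc u))
    ≡⟨ cong ((rr k t + rr k (suc t)) +_) (+-comm (rr k u) (rr k (suc u))) ⟩
  (rr k t + rr k (suc t)) + (rr k (suc u) + rr k u)
    ≡⟨ interchange (rr k t) (rr k (suc t)) (rr k (suc u)) (rr k u) ⟩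
  (rr k t + rr k (suc u)) + (rr k (suc t) + rr k u)
    ≡⟨ cong₂ _+_ (rr-complement k t (suc u) (trans (+-suc t u) 1+t+u≡))
                 (rr-complement k (suc t) u 1+t+u≡) ⟩
  hh k t + hh k (suc t)
    ≡⟨ hh-odd k t ⟨
  hh (suc k) (suc (t * 2))
    ∎

lemma4p2 : (k s : ℕ) → s ≤ 2 ^ k →
    (rr k s + rr k (2 ^ k ∸ s) ≡ hh k s) × (hh k (2 ^ k ∸ s) ≡ hh k s)
lemma4p2 k s s≤2^k = rr-complement k s (2 ^ k ∸ s) s+d≡2^k , hh-symmetric k s (2 ^ k ∸ s) s+d≡2^k
  where
  s+d≡2^k : s + (2 ^ k ∸ s) ≡ 2 ^ k
  s+d≡2^k = m+[n∸m]≡n s≤2^k
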